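{- Let $\mu$ be a partition with $m\geq1$ corners and corner weights $x_0,x_1,\dots,x_m$ and $u_0,u_1,\dots,u_m$. Then for every $k=1,\dots,m$ the expression $$B^{(k)}_\mu(q,t)=\frac{e_k[x_0+\cdots+x_m]-e_k[u_0+\cdots+u_m]}{(1-1/t)(1-1/q)}$$ is a polynomial in $q,t$ with positive integer coefficients.
   Context: Partitions in French convention; cell $(i,j)$ is the $j$-th cell of the $i$-th row from the bottom, with coleg $i-1$ and coarm $j-1$. A corner cell is one whose removal leaves a partition; order the $m$ corners $A_1,\dots,A_m$ from left to right. If $A_i$ has coleg $l_i$ and coarm $a_i$, set $x_i=t^{l_i}q^{a_i}$ ($1\le i\le m$), $x_0=1/(tq)$, $u_0=t^{l_1}/q$, $u_i=t^{l_{i+1}}q^{a_i}$ ($1\le i\le m-1$), $u_m=q^{a_m}/t$. $e_k[y_0+\cdots+y_m]$ denotes the $k$-th elementary symmetric function of $y_0,\dots,y_m$. -}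

module Defs where

open import Data.Nat as ℕ using (ℕ; zero; suc; _∸_; _<ᵇ_; _<_; _≥_)
open import Data.Integer as ℤ using (ℤ; +_; -[1+_])
open import Data.Bool using (if_then_else_; true; false)
open import Data.List using (List; []; _∷_; _++_; map; reverse; concatMap)
open import Data.List.Relation.Unary.All using (All)
open import Data.List.Relation.Unary.Linked using (Linked)
open import Data.Product using (_×_; _,_)
open import Relation.Nullary using (does)

-- A partition is the list of its row lengths, listed from the BOTTOM row
-- upwards: rows = λ₁ ∷ λ₂ ∷ … ∷ λᵣ with λ₁ ≥ λ₂ ≥ … ≥ λᵣ > 0.
-- Row i (1-based, from the bottom) contains the cells (i,1),…,(i,λᵢ).

record Partition : Set where
  constructor mkPartition
  field
    rows       : List ℕ
    decreasing : Linked _≥_ rows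
    positive   : All (0 <_) rows

open Partition public

-- The cell (i,j) of μ is a corner (its removal leaves a
-- partition) iff j = λᵢ and (i = r or λᵢ₊₁ < λᵢ).  Its coleg is i-1 and
-- its coarm is λᵢ - 1.  We record a corner as the pair (coleg , coarm).

-- corners listed from the bottom row upward, i.e. from RIGHT to LEFT;
-- the first argument is the coleg (i - 1) of the current row.
cornersRL : ℕ → List ℕ → List (ℕ × ℕ)
cornersRL i []              = []
cornersRL i (r ∷ [])        = (i , r ∸ 1) ∷ []
cornersRL i (r ∷ r' ∷ rest) =
  if r' <ᵇ r then (i , r ∸ 1) ∷ cornersRL (suc i) (r' ∷ rest)
             else cornersRL (suc i) (r' ∷ rest)

corners : Partition → List (ℕ × ℕ)
corners μ = reverse (cornersRL 0 (rows μ))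

-- Laurent polynomials in t, q with integer coefficients, represented as
-- finite formal sums of terms  c · t^e · q^f  stored as (c , e , f).

LPoly : Set
LPoly = List (ℤ × ℤ × ℤ)

mono : ℤ → ℤ → LPoly
mono e f = (ℤ.+ 1 , e , f) ∷ []

one : LPoly
one = mono (ℤ.+ 0) (ℤ.+ 0)

_⊕_ : LPoly → LPoly → LPoly
p ⊕ r = p ++ r

⊝_ : LPoly → LPoly
⊝ p = map (λ { (c , e , f) → (ℤ.- c , e , f) }) p

_⊗_ : LPoly → LPoly → LPoly
p ⊗ r = concatMap (λ { (c , e , f) →
          map (λ { (c' , e' , f') → (c ℤ.* c' , e ℤ.+ e' , f ℤ.+ f') }) r }) p

infixl 6 _⊕_
infixl 7 _⊗_
infix 4 _≈L_

coeff : LPoly → ℤ → ℤ → ℤ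
coeff [] e f = ℤ.+ 0
coeff ((c , e' , f') ∷ p) e f =
  if does (e' ℤ.≟ e) then (if does (f' ℤ.≟ f) then c ℤ.+ coeff p e f else coeff p e f)
                     else coeff p e f

_≈L_ : LPoly → LPoly → Set
p ≈L r = ∀ e f → coeff p e f Relation.Binary.PropositionalEquality.≡ coeff r e f
  where import Relation.Binary.PropositionalEquality

-- polynomials with coefficients in ℕ (nonnegative integers), terms
-- (c , e , f) meaning c · t^e · q^f with e, f ∈ ℕ
ℕPoly : Set
ℕPoly = List (ℕ × ℕ × ℕ)

embed : ℕPoly → LPoly
embed = map (λ { (c , e , f) → (ℤ.+ c , ℤ.+ e , ℤ.+ f) })

elem : ℕ → List LPoly → LPoly
elem zero    ys       = one
elem (suc k) []       = []
elem (suc k) (y ∷ ys) = elem (suc k) ys ⊕ y ⊗ elem k ys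

xWeights : List (ℕ × ℕ) → List LPoly
xWeights cs = mono (ℤ.- ℤ.+ 1) (ℤ.- ℤ.+ 1)
            ∷ map (λ { (l , a) → mono (ℤ.+ l) (ℤ.+ a) }) cs

uTail : List (ℕ × ℕ) → List LPoly
uTail []                         = []
uTail ((l , a) ∷ [])             = mono (ℤ.- ℤ.+ 1) (ℤ.+ a) ∷ []
uTail ((l , a) ∷ (l' , a') ∷ cs) = mono (ℤ.+ l') (ℤ.+ a) ∷ uTail ((l' , a') ∷ cs)

uWeights : List (ℕ × ℕ) → List LPoly
uWeights []             = []
uWeights ((l , a) ∷ cs) = mono (ℤ.+ l) (ℤ.- ℤ.+ 1) ∷ uTail ((l , a) ∷ cs)

denominator : LPoly
denominator = (one ⊕ ⊝ mono (ℤ.- ℤ.+ 1) (ℤ.+ 0)) ⊗ (one ⊕ ⊝ mono (ℤ.+ 0) (ℤ.- ℤ.+ 1))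

numerator : ℕ → Partition → LPoly
numerator k μ = elem k (xWeights (corners μ)) ⊕ ⊝ elem k (uWeights (corners μ))

-- Let (l, a) be the leftmost corner, (l', a') the next one, N_k the numerator e_k[x] − e_k[u], and primes
-- refer to the corner list without (l, a). There x₁, u₀, u₁ are replaced by the single weight u₀' = t^{l'}/q,
-- and expanding e_k in these weights (the e_{k−2} terms cancel because x₁u₀' = u₀u₁) gives
--   N_k = N_k' + x₁ N_{k−1}' + (t^l − t^{l'})(q^a − q⁻¹) e_{k−1}[u₂ + ⋯ + u_m].          (†)
-- Telescoping, (t^l − t^{l'})(q^a − q⁻¹) = (1 − 1/t)(1 − 1/q) · t · Σ t^i q^j over l' ≤ i < l, 0 ≤ j ≤ a,
-- and t · e_{k−1}[u₂ + ⋯ + u_m] has nonnegative exponents, since u_m = q^{a_m}/t is the only weight with a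
-- negative one. So by induction on the number of corners N_k is (1 − 1/t)(1 − 1/q) times a polynomial with
-- coefficients in ℕ. For a single corner N_1 is the sum over the (l+1) × (a+1) rectangle times
-- (1 − 1/t)(1 − 1/q), and N_k = 0 for k ≥ 2.

module Submission where

open import Defs
open import Algebra.Bundles using (CommutativeRing)
open import Algebra.Structures using (IsCommutativeRing)
import Algebra.Consequences.Setoid as Consequences
open import Data.Bool using (true; false)
open import Data.Integer as ℤ using (ℤ; +_; -[1+_]; _+_; _-_; -_; _*_; _≟_)
import Data.Integer.Properties as ℤ
open import Data.Integer.Tactic.RingSolver renaming (solve-∀ to ℤ-solve-∀)
open import Data.List using (List; []; _∷_; _++_; map; concatMap; reverse; foldl; length)
open import Data.List.Properties using (++-assoc; ++-identityʳ; map-cong; map-id; map-∘; map-++; concatMap-++)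
open import Data.List.Relation.Unary.All as All using (all?)
open import Data.List.Relation.Unary.Any using (Any; here; there)
open import Data.List.Relation.Unary.Linked using (Linked; []; [-]; _∷_; tail)
open import Data.List.Relation.Unary.Linked.Properties using (map⁻)
open import Data.Maybe using (Maybe; just; nothing)
open import Data.Nat as ℕ using (ℕ; zero; suc; _∸_; _<ᵇ_; _≤_)
import Data.Nat.Properties as ℕ
open import Data.Product using (_×_; _,_; proj₁; proj₂; ∃-syntax)
open import Function using (flip)
open import Function.Bundles using (mk⇔)
open import Level using (0ℓ)
open import Relation.Binary.Bundles using (Setoid)
open import Relation.Binary.PropositionalEquality
import Relation.Binary.Reasoning.Setoid
open import Relation.Nullary using (does; yes; no; contradiction)
open import Relation.Nullary.Decidable using (does-⇔)
open import Tactic.RingSolver using (solve-∀)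
open import Tactic.RingSolver.Core.AlmostCommutativeRing using (AlmostCommutativeRing; fromCommutativeRing)

-- Laurent polynomials form a commutative ring

Term : Set
Term = ℤ × ℤ × ℤ

-- p ⊗ r is definitionally concatMap (λ s → map (s ·_) r) p.
_·_ : Term → Term → Term
(c , e , f) · (c' , e' , f') = (c * c' , e + e' , f + f')

·-assoc : ∀ s u v → (s · u) · v ≡ s · (u · v)
·-assoc (c , e , f) (c' , e' , f') (c'' , e'' , f'') =
  cong₂ _,_ (ℤ.*-assoc c c' c'') (cong₂ _,_ (ℤ.+-assoc e e' e'') (ℤ.+-assoc f f' f''))

·-comm : ∀ s u → s · u ≡ u · s
·-comm (c , e , f) (c' , e' , f') =
  cong₂ _,_ (ℤ.*-comm c c') (cong₂ _,_ (ℤ.+-comm e e') (ℤ.+-comm f f'))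

coeff-∷ : ∀ s p e f → coeff (s ∷ p) e f ≡ coeff (s ∷ []) e f + coeff p e f
coeff-∷ (c , e' , f') p e f with does (e' ≟ e) | does (f' ≟ f)
... | false | _     = sym (ℤ.+-identityˡ (coeff p e f))
... | true  | false = sym (ℤ.+-identityˡ (coeff p e f))
... | true  | true  = cong (_+ coeff p e f) (sym (ℤ.+-identityʳ c))

coeff-⊕ : ∀ p r e f → coeff (p ⊕ r) e f ≡ coeff p e f + coeff r e f
coeff-⊕ []      r e f = sym (ℤ.+-identityˡ (coeff r e f))
coeff-⊕ (s ∷ p) r e f = begin
  coeff (s ∷ p ⊕ r) e f                                ≡⟨ coeff-∷ s (p ⊕ r) e f ⟩
  coeff (s ∷ []) e f + coeff (p ⊕ r) e f               ≡⟨ cong (_+_ (coeff (s ∷ []) e f)) (coeff-⊕ p r e f) ⟩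
  coeff (s ∷ []) e f + (coeff p e f + coeff r e f)     ≡⟨ ℤ.+-assoc (coeff (s ∷ []) e f) (coeff p e f) (coeff r e f) ⟨
  coeff (s ∷ []) e f + coeff p e f + coeff r e f       ≡⟨ cong (_+ coeff r e f) (coeff-∷ s p e f) ⟨
  coeff (s ∷ p) e f + coeff r e f                      ∎
  where open ≡-Reasoning

coeff-⊝ : ∀ p e f → coeff (⊝ p) e f ≡ - coeff p e f
coeff-⊝ []              e f = refl
coeff-⊝ ((c , a , b) ∷ p) e f with does (a ≟ e) | does (b ≟ f)
... | false | _     = coeff-⊝ p e f
... | true  | false = coeff-⊝ p e f
... | true  | true  = trans (cong (_+_ (- c)) (coeff-⊝ p e f)) (sym (ℤ.neg-distrib-+ c (coeff p e f)))

does-≟-shift : ∀ a x e → does (a + x ≟ e) ≡ does (x ≟ e - a)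
does-≟-shift a x e = does-⇔ (mk⇔ (λ p → trans (sym (cancel a x)) (cong (_- a) p))
                                 (λ q → trans (cong (_+_ a) q) (uncancel a e)))
                            (a + x ≟ e) (x ≟ e - a)
  where
  cancel : ∀ a x → a + x - a ≡ x
  cancel = ℤ-solve-∀
  uncancel : ∀ a e → a + (e - a) ≡ e
  uncancel = ℤ-solve-∀

coeff-· : ∀ c a b u e f → coeff ((c , a , b) · u ∷ []) e f ≡ c * coeff (u ∷ []) (e - a) (f - b)
coeff-· c a b (c' , a' , b') e f
  rewrite does-≟-shift a a' e | does-≟-shift b b' f
  with does (a' ≟ e - a) | does (b' ≟ f - b)
... | false | _     = sym (ℤ.*-zeroʳ c)
... | true  | false = sym (ℤ.*-zeroʳ c)
... | true  | true  = trans (ℤ.+-identityʳ (c * c')) (cong (c *_) (sym (ℤ.+-identityʳ c')))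

coeff-map-· : ∀ c a b r e f → coeff (map ((c , a , b) ·_) r) e f ≡ c * coeff r (e - a) (f - b)
coeff-map-· c a b []      e f = sym (ℤ.*-zeroʳ c)
coeff-map-· c a b (u ∷ r) e f = begin
  coeff ((c , a , b) · u ∷ map ((c , a , b) ·_) r) e f
    ≡⟨ coeff-∷ ((c , a , b) · u) (map ((c , a , b) ·_) r) e f ⟩
  coeff ((c , a , b) · u ∷ []) e f + coeff (map ((c , a , b) ·_) r) e f
    ≡⟨ cong₂ _+_ (coeff-· c a b u e f) (coeff-map-· c a b r e f) ⟩
  c * coeff (u ∷ []) (e - a) (f - b) + c * coeff r (e - a) (f - b)
    ≡⟨ ℤ.*-distribˡ-+ c _ _ ⟨
  c * (coeff (u ∷ []) (e - a) (f - b) + coeff r (e - a) (f - b))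
    ≡⟨ cong (c *_) (coeff-∷ u r (e - a) (f - b)) ⟨
  c * coeff (u ∷ r) (e - a) (f - b) ∎
  where open ≡-Reasoning

coeff-⊗-congʳ : ∀ p {r r'} → r ≈L r' → p ⊗ r ≈L p ⊗ r'
coeff-⊗-congʳ []                {r} {r'} r≈r' e f = refl
coeff-⊗-congʳ ((c , a , b) ∷ p) {r} {r'} r≈r' e f = begin
  coeff (map ((c , a , b) ·_) r ⊕ p ⊗ r) e f
    ≡⟨ coeff-⊕ (map ((c , a , b) ·_) r) (p ⊗ r) e f ⟩
  coeff (map ((c , a , b) ·_) r) e f + coeff (p ⊗ r) e f
    ≡⟨ cong₂ _+_ (coeff-map-· c a b r e f) (coeff-⊗-congʳ p r≈r' e f) ⟩
  c * coeff r (e - a) (f - b) + coeff (p ⊗ r') e f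
    ≡⟨ cong (λ z → c * z + coeff (p ⊗ r') e f) (r≈r' (e - a) (f - b)) ⟩
  c * coeff r' (e - a) (f - b) + coeff (p ⊗ r') e f
    ≡⟨ cong (_+ coeff (p ⊗ r') e f) (coeff-map-· c a b r' e f) ⟨
  coeff (map ((c , a , b) ·_) r') e f + coeff (p ⊗ r') e f
    ≡⟨ coeff-⊕ (map ((c , a , b) ·_) r') (p ⊗ r') e f ⟨
  coeff (map ((c , a , b) ·_) r' ⊕ p ⊗ r') e f ∎
  where open ≡-Reasoning

⊗-distribʳ : ∀ p p' r → (p ⊕ p') ⊗ r ≡ p ⊗ r ⊕ p' ⊗ r
⊗-distribʳ p p' r = concatMap-++ (λ s → map (s ·_) r) p p'

map-·-⊗ : ∀ s r v → map (s ·_) r ⊗ v ≡ map (s ·_) (r ⊗ v)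
map-·-⊗ s []      v = refl
map-·-⊗ s (u ∷ r) v = begin
  map ((s · u) ·_) v ⊕ map (s ·_) r ⊗ v        ≡⟨ cong₂ _⊕_ (map-cong (·-assoc s u) v) (map-·-⊗ s r v) ⟩
  map (λ w → s · (u · w)) v ⊕ map (s ·_) (r ⊗ v) ≡⟨ cong (_⊕ map (s ·_) (r ⊗ v)) (map-∘ v) ⟩
  map (s ·_) (map (u ·_) v) ⊕ map (s ·_) (r ⊗ v) ≡⟨ map-++ (s ·_) (map (u ·_) v) (r ⊗ v) ⟨
  map (s ·_) (map (u ·_) v ⊕ r ⊗ v)             ∎
  where open ≡-Reasoning

⊗-assoc : ∀ p r v → (p ⊗ r) ⊗ v ≡ p ⊗ (r ⊗ v)
⊗-assoc []      r v = refl
⊗-assoc (s ∷ p) r v = begin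
  (map (s ·_) r ⊕ p ⊗ r) ⊗ v        ≡⟨ ⊗-distribʳ (map (s ·_) r) (p ⊗ r) v ⟩
  map (s ·_) r ⊗ v ⊕ (p ⊗ r) ⊗ v    ≡⟨ cong₂ _⊕_ (map-·-⊗ s r v) (⊗-assoc p r v) ⟩
  map (s ·_) (r ⊗ v) ⊕ p ⊗ (r ⊗ v)  ∎
  where open ≡-Reasoning

coeff-⊗-∷ʳ : ∀ p u r e f → coeff (p ⊗ (u ∷ r)) e f ≡ coeff (map (_· u) p) e f + coeff (p ⊗ r) e f
coeff-⊗-∷ʳ []      u r e f = refl
coeff-⊗-∷ʳ (s ∷ p) u r e f = begin
  coeff (s · u ∷ map (s ·_) r ⊕ p ⊗ (u ∷ r)) e f
    ≡⟨ coeff-∷ (s · u) (map (s ·_) r ⊕ p ⊗ (u ∷ r)) e f ⟩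
  S + coeff (map (s ·_) r ⊕ p ⊗ (u ∷ r)) e f
    ≡⟨ cong (_+_ S) (coeff-⊕ (map (s ·_) r) (p ⊗ (u ∷ r)) e f) ⟩
  S + (R + coeff (p ⊗ (u ∷ r)) e f)
    ≡⟨ cong (λ z → S + (R + z)) (coeff-⊗-∷ʳ p u r e f) ⟩
  S + (R + (P + Q))
    ≡⟨ swap S R P Q ⟩
  (S + P) + (R + Q)
    ≡⟨ cong₂ _+_ (coeff-∷ (s · u) (map (_· u) p) e f) (coeff-⊕ (map (s ·_) r) (p ⊗ r) e f) ⟨
  coeff (s · u ∷ map (_· u) p) e f + coeff (map (s ·_) r ⊕ p ⊗ r) e f ∎
  where
  open ≡-Reasoning
  S = coeff (s · u ∷ []) e f
  R = coeff (map (s ·_) r) e f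
  P = coeff (map (_· u) p) e f
  Q = coeff (p ⊗ r) e f
  swap : ∀ S R P Q → S + (R + (P + Q)) ≡ (S + P) + (R + Q)
  swap = ℤ-solve-∀

coeff-⊗-comm : ∀ p r → p ⊗ r ≈L r ⊗ p
coeff-⊗-comm []      r e f = sym (vanishes r)
  where
  vanishes : ∀ r → coeff (r ⊗ []) e f ≡ + 0
  vanishes []      = refl
  vanishes (_ ∷ r) = vanishes r
coeff-⊗-comm (s ∷ p) r e f = begin
  coeff (map (s ·_) r ⊕ p ⊗ r) e f               ≡⟨ coeff-⊕ (map (s ·_) r) (p ⊗ r) e f ⟩
  coeff (map (s ·_) r) e f + coeff (p ⊗ r) e f   ≡⟨ cong₂ _+_ (cong (λ z → coeff z e f) (map-cong (·-comm s) r)) (coeff-⊗-comm p r e f) ⟩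
  coeff (map (_· s) r) e f + coeff (r ⊗ p) e f   ≡⟨ coeff-⊗-∷ʳ r s p e f ⟨
  coeff (r ⊗ (s ∷ p)) e f                        ∎
  where open ≡-Reasoning

⊗-identityˡ : ∀ r → one ⊗ r ≡ r
⊗-identityˡ r = trans (++-identityʳ _) (trans (map-cong unit r) (map-id r))
  where
  unit : ∀ u → (+ 1 , + 0 , + 0) · u ≡ u
  unit (c , e , f) = cong₂ _,_ (ℤ.*-identityˡ c) (cong₂ _,_ (ℤ.+-identityˡ e) (ℤ.+-identityˡ f))

infix 4 _≋_

-- _≈L_ wrapped in a record, so that both sides of an equation can be inferred by unification
-- (which the ring solver relies on).
record _≋_ (p r : LPoly) : Set where
  constructor coeffwise
  field coeff-≡ : p ≈L r

open _≋_ public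

≋-setoid : Setoid 0ℓ 0ℓ
≋-setoid = record
  { Carrier = LPoly
  ; _≈_ = _≋_
  ; isEquivalence = record
    { refl  = coeffwise λ _ _ → refl
    ; sym   = λ p≋r → coeffwise λ e f → sym (coeff-≡ p≋r e f)
    ; trans = λ p≋r r≋v → coeffwise λ e f → trans (coeff-≡ p≋r e f) (coeff-≡ r≋v e f)
    }
  }

module ≋-Reasoning = Relation.Binary.Reasoning.Setoid ≋-setoid

≋-refl : ∀ {p} → p ≋ p
≋-refl = Setoid.refl ≋-setoid

≡⇒≋ : ∀ {p r} → p ≡ r → p ≋ r
≡⇒≋ refl = coeffwise λ _ _ → refl

⊕-cong : ∀ {p p' r r'} → p ≋ p' → r ≋ r' → p ⊕ r ≋ p' ⊕ r'
⊕-cong {p} {p'} {r} {r'} p≋p' r≋r' = coeffwise λ e f →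
  trans (coeff-⊕ p r e f) (trans (cong₂ _+_ (coeff-≡ p≋p' e f) (coeff-≡ r≋r' e f)) (sym (coeff-⊕ p' r' e f)))

⊕-congˡ : ∀ p {r r'} → r ≋ r' → p ⊕ r ≋ p ⊕ r'
⊕-congˡ p = ⊕-cong (≋-refl {p})

⊕-comm : ∀ p r → p ⊕ r ≋ r ⊕ p
⊕-comm p r = coeffwise λ e f →
  trans (coeff-⊕ p r e f) (trans (ℤ.+-comm (coeff p e f) (coeff r e f)) (sym (coeff-⊕ r p e f)))

⊝-cong : ∀ {p p'} → p ≋ p' → ⊝ p ≋ ⊝ p'
⊝-cong {p} {p'} p≋p' = coeffwise λ e f →
  trans (coeff-⊝ p e f) (trans (cong -_ (coeff-≡ p≋p' e f)) (sym (coeff-⊝ p' e f)))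

⊝-inverseˡ : ∀ p → ⊝ p ⊕ p ≋ []
⊝-inverseˡ p = coeffwise λ e f →
  trans (coeff-⊕ (⊝ p) p e f) (trans (cong (_+ coeff p e f) (coeff-⊝ p e f)) (ℤ.+-inverseˡ (coeff p e f)))

⊗-comm : ∀ p r → p ⊗ r ≋ r ⊗ p
⊗-comm p r = coeffwise (coeff-⊗-comm p r)

⊗-cong : ∀ {p p' r r'} → p ≋ p' → r ≋ r' → p ⊗ r ≋ p' ⊗ r'
⊗-cong {p} {p'} {r} {r'} p≋p' r≋r' = begin
  p ⊗ r    ≈⟨ coeffwise (coeff-⊗-congʳ p (coeff-≡ r≋r')) ⟩
  p ⊗ r'   ≈⟨ ⊗-comm p r' ⟩
  r' ⊗ p   ≈⟨ coeffwise (coeff-⊗-congʳ r' (coeff-≡ p≋p')) ⟩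
  r' ⊗ p'  ≈⟨ ⊗-comm r' p' ⟩
  p' ⊗ r'  ∎
  where open ≋-Reasoning

⊗-congˡ : ∀ p {r r'} → r ≋ r' → p ⊗ r ≋ p ⊗ r'
⊗-congˡ p = ⊗-cong (≋-refl {p})

⊗-congʳ : ∀ {p p'} r → p ≋ p' → p ⊗ r ≋ p' ⊗ r
⊗-congʳ r p≋p' = ⊗-cong p≋p' (≋-refl {r})

LPoly-isCommutativeRing : IsCommutativeRing _≋_ _⊕_ _⊗_ ⊝_ [] one
LPoly-isCommutativeRing = record
  { isRing = record
    { +-isAbelianGroup = record
      { isGroup = record
        { isMonoid = record
          { isSemigroup = record
            { isMagma = record { isEquivalence = Setoid.isEquivalence ≋-setoid ; ∙-cong = ⊕-cong }
            ; assoc = λ p r v → ≡⇒≋ (++-assoc p r v)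
            }
          ; identity = (λ p → ≡⇒≋ refl) , (λ p → ≡⇒≋ (++-identityʳ p))
          }
        ; inverse = comm∧invˡ⇒inv ⊕-comm ⊝-inverseˡ
        ; ⁻¹-cong = ⊝-cong
        }
      ; comm = ⊕-comm
      }
    ; *-cong = ⊗-cong
    ; *-assoc = λ p r v → ≡⇒≋ (⊗-assoc p r v)
    ; *-identity = comm∧idˡ⇒id ⊗-comm (λ r → ≡⇒≋ (⊗-identityˡ r))
    ; distrib = comm∧distrʳ⇒distr ⊕-cong ⊗-comm (λ r p p' → ≡⇒≋ (⊗-distribʳ p p' r))
    }
  ; *-comm = ⊗-comm
  }
  where open Consequences ≋-setoid

LPoly-commutativeRing : CommutativeRing 0ℓ 0ℓ
LPoly-commutativeRing = record { isCommutativeRing = LPoly-isCommutativeRing }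

coeff-support : ∀ p e f → coeff p e f ≢ + 0 → Any (λ s → proj₂ s ≡ (e , f)) p
coeff-support []                e f c≢0 = contradiction refl c≢0
coeff-support ((c , a , b) ∷ p) e f c≢0 with a ≟ e | b ≟ f
... | yes refl | yes refl = here refl
... | yes _    | no _     = there (coeff-support p e f c≢0)
... | no _     | _        = there (coeff-support p e f c≢0)

-- The ring solver uses this test to discard cancelled coefficients; it suffices to check the exponent
-- pairs occurring in p.
≋-zero? : ∀ p → Maybe ([] ≋ p)
≋-zero? p with all? (λ s → coeff p (proj₁ (proj₂ s)) (proj₂ (proj₂ s)) ≟ + 0) p
... | no _         = nothing
... | yes vanishes = just (coeffwise λ e f → sym (vanishes-everywhere e f))
  where
  vanishes-everywhere : ∀ e f → coeff p e f ≡ + 0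
  vanishes-everywhere e f with coeff p e f ≟ + 0
  ... | yes c≡0 = c≡0
  ... | no  c≢0 = All.lookupWith (λ c≡0 s≡ef → subst (λ (x , y) → coeff p x y ≡ + 0) s≡ef c≡0)
                                 vanishes (coeff-support p e f c≢0)

LPoly-ring : AlmostCommutativeRing 0ℓ 0ℓ
LPoly-ring = fromCommutativeRing LPoly-commutativeRing ≋-zero?

⊗-zeroʳ-cancel : ∀ p m → p ⊗ [] ≋ m ⊕ ⊝ m
⊗-zeroʳ-cancel = solve-∀ LPoly-ring

-- Polynomials with coefficients in ℕ, and telescoping rectangles

_⊗ℕ_ : ℕPoly → ℕPoly → ℕPoly
P ⊗ℕ Q = concatMap (λ (c , e , f) → map (λ (c' , e' , f') → (c ℕ.* c' , e ℕ.+ e' , f ℕ.+ f')) Q) P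

infixl 7 _⊗ℕ_

monoℕ : ℕ → ℕ → ℕPoly
monoℕ e f = (1 , e , f) ∷ []

embed-⊕ : ∀ P Q → embed (P ++ Q) ≡ embed P ⊕ embed Q
embed-⊕ P Q = map-++ _ P Q

embed-⊗ : ∀ P Q → embed (P ⊗ℕ Q) ≡ embed P ⊗ embed Q
embed-⊗ []      Q = refl
embed-⊗ ((c , e , f) ∷ P) Q = begin
  embed (scaled ++ P ⊗ℕ Q)              ≡⟨ embed-⊕ scaled (P ⊗ℕ Q) ⟩
  embed scaled ⊕ embed (P ⊗ℕ Q)         ≡⟨ cong₂ _⊕_ termwise (embed-⊗ P Q) ⟩
  map ((+ c , + e , + f) ·_) (embed Q) ⊕ embed P ⊗ embed Q ∎
  where
  open ≡-Reasoning
  scaled = map (λ (c' , e' , f') → (c ℕ.* c' , e ℕ.+ e' , f ℕ.+ f')) Q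
  termwise : embed scaled ≡ map ((+ c , + e , + f) ·_) (embed Q)
  termwise = trans (sym (map-∘ Q)) (trans (map-cong (λ (c' , e' , f') → cong (_, + (e ℕ.+ e') , + (f ℕ.+ f')) (ℤ.pos-* c c')) Q) (map-∘ Q))

𝐭 𝐪 : LPoly
𝐭 = mono (+ 1) (+ 0)
𝐪 = mono (+ 0) (+ 1)

row : ℕ → ℕ → ℕ → ℕPoly
row r c zero    = []
row r c (suc w) = monoℕ r c ++ row r (suc c) w

rectangle : ℕ → ℕ → ℕ → ℕ → ℕPoly
rectangle r c zero    w = []
rectangle r c (suc h) w = row r c w ++ rectangle (suc r) c h w

row-telescopes : ∀ r c w → (𝐪 ⊕ ⊝ one) ⊗ embed (row r c w) ≋ mono (+ r) (+ (c ℕ.+ w)) ⊕ ⊝ mono (+ r) (+ c)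
row-telescopes r c zero rewrite ℕ.+-identityʳ c = ⊗-zeroʳ-cancel (𝐪 ⊕ ⊝ one) (mono (+ r) (+ c))
row-telescopes r c (suc w) = begin
  (𝐪 ⊕ ⊝ one) ⊗ (m ⊕ rest)                    ≈⟨ distrib (𝐪 ⊕ ⊝ one) m rest ⟩
  (𝐪 ⊕ ⊝ one) ⊗ m ⊕ (𝐪 ⊕ ⊝ one) ⊗ rest        ≈⟨ ⊕-congˡ ((𝐪 ⊕ ⊝ one) ⊗ m) (row-telescopes r (suc c) w) ⟩
  (m' ⊕ ⊝ m) ⊕ (mono (+ r) (+ (suc c ℕ.+ w)) ⊕ ⊝ m')  ≈⟨ telescope m m' (mono (+ r) (+ (suc c ℕ.+ w))) ⟩
  mono (+ r) (+ (suc c ℕ.+ w)) ⊕ ⊝ m           ≡⟨ cong (λ n → mono (+ r) (+ n) ⊕ ⊝ m) (sym (ℕ.+-suc c w)) ⟩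
  mono (+ r) (+ (c ℕ.+ suc w)) ⊕ ⊝ m           ∎
  where
  open ≋-Reasoning
  m = mono (+ r) (+ c)
  m' = mono (+ r) (+ suc c)
  rest = embed (row r (suc c) w)
  distrib : ∀ y a b → y ⊗ (a ⊕ b) ≋ y ⊗ a ⊕ y ⊗ b
  distrib = solve-∀ LPoly-ring
  telescope : ∀ a b e → (b ⊕ ⊝ a) ⊕ (e ⊕ ⊝ b) ≋ e ⊕ ⊝ a
  telescope = solve-∀ LPoly-ring

rectangle-telescopes : ∀ r c h w →
  denominator ⊗ mono (+ 1) (+ 1) ⊗ embed (rectangle r c h w) ≋
  mono (+ (r ℕ.+ h)) (+ (c ℕ.+ w)) ⊕ ⊝ mono (+ r) (+ (c ℕ.+ w)) ⊕ ⊝ mono (+ (r ℕ.+ h)) (+ c) ⊕ mono (+ r) (+ c)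
rectangle-telescopes r c zero w rewrite ℕ.+-identityʳ r =
  annihilate (denominator ⊗ mono (+ 1) (+ 1)) (mono (+ r) (+ (c ℕ.+ w))) (mono (+ r) (+ c))
  where
  annihilate : ∀ y a b → y ⊗ [] ≋ a ⊕ ⊝ a ⊕ ⊝ b ⊕ b
  annihilate = solve-∀ LPoly-ring
rectangle-telescopes r c (suc h) w = begin
  ((𝐭 ⊕ ⊝ one) ⊗ (𝐪 ⊕ ⊝ one)) ⊗ embed (row r c w ++ rectangle (suc r) c h w)
    ≡⟨ cong (((𝐭 ⊕ ⊝ one) ⊗ (𝐪 ⊕ ⊝ one)) ⊗_) (embed-⊕ (row r c w) (rectangle (suc r) c h w)) ⟩
  ((𝐭 ⊕ ⊝ one) ⊗ (𝐪 ⊕ ⊝ one)) ⊗ (bottom ⊕ rest)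
    ≈⟨ split 𝐭 𝐪 bottom rest ⟩
  (𝐭 ⊕ ⊝ one) ⊗ ((𝐪 ⊕ ⊝ one) ⊗ bottom) ⊕ ((𝐭 ⊕ ⊝ one) ⊗ (𝐪 ⊕ ⊝ one)) ⊗ rest
    ≈⟨ ⊕-cong (⊗-congˡ (𝐭 ⊕ ⊝ one) (row-telescopes r c w)) (rectangle-telescopes (suc r) c h w) ⟩
  (𝐭 ⊕ ⊝ one) ⊗ (a ⊕ ⊝ b) ⊕ (e ⊕ ⊝ (𝐭 ⊗ a) ⊕ ⊝ f ⊕ 𝐭 ⊗ b)
    ≈⟨ telescope 𝐭 a b e f ⟩
  e ⊕ ⊝ a ⊕ ⊝ f ⊕ b
    ≡⟨ cong (λ n → mono (+ n) (+ (c ℕ.+ w)) ⊕ ⊝ a ⊕ ⊝ mono (+ n) (+ c) ⊕ b) (sym (ℕ.+-suc r h)) ⟩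
  mono (+ (r ℕ.+ suc h)) (+ (c ℕ.+ w)) ⊕ ⊝ a ⊕ ⊝ mono (+ (r ℕ.+ suc h)) (+ c) ⊕ b ∎
  where
  open ≋-Reasoning
  bottom = embed (row r c w)
  rest = embed (rectangle (suc r) c h w)
  a = mono (+ r) (+ (c ℕ.+ w))
  b = mono (+ r) (+ c)
  e = mono (+ (suc r ℕ.+ h)) (+ (c ℕ.+ w))
  f = mono (+ (suc r ℕ.+ h)) (+ c)
  split : ∀ x y u v → ((x ⊕ ⊝ one) ⊗ (y ⊕ ⊝ one)) ⊗ (u ⊕ v) ≋ (x ⊕ ⊝ one) ⊗ ((y ⊕ ⊝ one) ⊗ u) ⊕ ((x ⊕ ⊝ one) ⊗ (y ⊕ ⊝ one)) ⊗ v
  split = solve-∀ LPoly-ring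
  telescope : ∀ x a b e f → (x ⊕ ⊝ one) ⊗ (a ⊕ ⊝ b) ⊕ (e ⊕ ⊝ (x ⊗ a) ⊕ ⊝ f ⊕ x ⊗ b) ≋ e ⊕ ⊝ a ⊕ ⊝ f ⊕ b
  telescope = solve-∀ LPoly-ring

-- Removing the leftmost corner

-- t · e_j[uTail cs]: the factor t clears the only negative exponent, that of the last weight q^{a_m}/t.
tElemUTail : ℕ → List (ℕ × ℕ) → ℕPoly
tElemUTail zero          cs                       = monoℕ 1 0
tElemUTail (suc j)       []                       = []
tElemUTail (suc j)       ((l , a) ∷ rest@((l' , _) ∷ _)) =
  tElemUTail (suc j) rest ++ monoℕ l' a ⊗ℕ tElemUTail j rest
tElemUTail (suc zero)    ((l , a) ∷ [])            = monoℕ 0 a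
tElemUTail (suc (suc j)) ((l , a) ∷ [])            = []

embed-tElemUTail : ∀ j cs → embed (tElemUTail j cs) ≋ 𝐭 ⊗ elem j (uTail cs)
embed-tElemUTail zero          cs             = ≋-refl
embed-tElemUTail (suc j)       []             = ≋-refl
embed-tElemUTail (suc zero)    ((l , a) ∷ [])  = collapse 𝐭 (mono -[1+ 0 ] (+ a))
  where
  collapse : ∀ x y → x ⊗ y ≋ x ⊗ ([] ⊕ y ⊗ one)
  collapse = solve-∀ LPoly-ring
embed-tElemUTail (suc (suc j)) ((l , a) ∷ [])  = ≋-refl
embed-tElemUTail (suc j) ((l , a) ∷ rest@((l' , a') ∷ _)) = begin
  embed (tElemUTail (suc j) rest ++ monoℕ l' a ⊗ℕ tElemUTail j rest)
    ≡⟨ trans (embed-⊕ (tElemUTail (suc j) rest) _) (cong (embed (tElemUTail (suc j) rest) ⊕_) (embed-⊗ (monoℕ l' a) (tElemUTail j rest))) ⟩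
  embed (tElemUTail (suc j) rest) ⊕ u ⊗ embed (tElemUTail j rest)
    ≈⟨ ⊕-cong (embed-tElemUTail (suc j) rest) (⊗-congˡ u (embed-tElemUTail j rest)) ⟩
  𝐭 ⊗ elem (suc j) (uTail rest) ⊕ u ⊗ (𝐭 ⊗ elem j (uTail rest))
    ≈⟨ factor 𝐭 u (elem (suc j) (uTail rest)) (elem j (uTail rest)) ⟩
  𝐭 ⊗ (elem (suc j) (uTail rest) ⊕ u ⊗ elem j (uTail rest)) ∎
  where
  open ≋-Reasoning
  u = mono (+ l') (+ a)
  factor : ∀ t u e e' → t ⊗ e ⊕ u ⊗ (t ⊗ e') ≋ t ⊗ (e ⊕ u ⊗ e')
  factor = solve-∀ LPoly-ring

cornerNumerator : ℕ → List (ℕ × ℕ) → LPoly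
cornerNumerator k cs = elem k (xWeights cs) ⊕ ⊝ elem k (uWeights cs)

strip : ℕ → ℕ → ℕ → LPoly
strip l l' a = mono (+ l) (+ a) ⊕ ⊝ mono (+ l') (+ a) ⊕ ⊝ mono (+ l) -[1+ 0 ] ⊕ mono (+ l') -[1+ 0 ]

cornerNumerator-step : ∀ j l a l' a' cs → let rest = (l' , a') ∷ cs in
  cornerNumerator (suc j) ((l , a) ∷ rest) ≋
  cornerNumerator (suc j) rest ⊕ (mono (+ l) (+ a) ⊗ cornerNumerator j rest ⊕ strip l l' a ⊗ elem j (uTail rest))
cornerNumerator-step zero l a l' a' cs =
  expand (elem 1 (map (λ (l , a) → mono (+ l) (+ a)) ((l' , a') ∷ cs))) (elem 1 (uTail ((l' , a') ∷ cs)))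
         (mono -[1+ 0 ] -[1+ 0 ]) (mono (+ l) (+ a)) (mono (+ l) -[1+ 0 ]) (mono (+ l') (+ a)) (mono (+ l') -[1+ 0 ])
  where
  expand : ∀ z v x₀ x u₀ u u₀' →
    ((z ⊕ x ⊗ one) ⊕ x₀ ⊗ one) ⊕ ⊝ ((v ⊕ u ⊗ one) ⊕ u₀ ⊗ one) ≋
    ((z ⊕ x₀ ⊗ one) ⊕ ⊝ (v ⊕ u₀' ⊗ one)) ⊕ (x ⊗ (one ⊕ ⊝ one) ⊕ (x ⊕ ⊝ u ⊕ ⊝ u₀ ⊕ u₀') ⊗ one)
  expand = solve-∀ LPoly-ring
cornerNumerator-step (suc i) l a l' a' cs = begin
  lhs                                  ≈⟨ expand z₂ z₁ z₀ v₂ v₁ v₀ x₀ x u₀ u u₀' ⟩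
  rhs ⊕ v₀ ⊗ (x ⊗ u₀' ⊕ ⊝ (u₀ ⊗ u))  ≡⟨ cong (λ m → rhs ⊕ v₀ ⊗ (m ⊕ ⊝ (u₀ ⊗ u))) (cong (mono (+ l ℤ.+ + l')) (ℤ.+-comm (+ a) -[1+ 0 ])) ⟩
  rhs ⊕ v₀ ⊗ (u₀ ⊗ u ⊕ ⊝ (u₀ ⊗ u))  ≈⟨ cancel rhs v₀ (u₀ ⊗ u) ⟩
  rhs                                  ∎
  where
  open ≋-Reasoning
  rest = (l' , a') ∷ cs
  Z = map (λ (l , a) → mono (+ l) (+ a)) rest
  V = uTail rest
  z₂ = elem (suc (suc i)) Z
  z₁ = elem (suc i) Z
  z₀ = elem i Z
  v₂ = elem (suc (suc i)) V
  v₁ = elem (suc i) V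
  v₀ = elem i V
  x₀ = mono -[1+ 0 ] -[1+ 0 ]
  x = mono (+ l) (+ a)
  u₀ = mono (+ l) -[1+ 0 ]
  u = mono (+ l') (+ a)
  u₀' = mono (+ l') -[1+ 0 ]
  lhs = cornerNumerator (suc (suc i)) ((l , a) ∷ rest)
  rhs = cornerNumerator (suc (suc i)) rest ⊕ (x ⊗ cornerNumerator (suc i) rest ⊕ strip l l' a ⊗ v₁)
  expand : ∀ z₂ z₁ z₀ v₂ v₁ v₀ x₀ x u₀ u u₀' →
    ((z₂ ⊕ x ⊗ z₁) ⊕ x₀ ⊗ (z₁ ⊕ x ⊗ z₀)) ⊕ ⊝ ((v₂ ⊕ u ⊗ v₁) ⊕ u₀ ⊗ (v₁ ⊕ u ⊗ v₀)) ≋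
    ((z₂ ⊕ x₀ ⊗ z₁) ⊕ ⊝ (v₂ ⊕ u₀' ⊗ v₁))
      ⊕ (x ⊗ ((z₁ ⊕ x₀ ⊗ z₀) ⊕ ⊝ (v₁ ⊕ u₀' ⊗ v₀)) ⊕ (x ⊕ ⊝ u ⊕ ⊝ u₀ ⊕ u₀') ⊗ v₁)
      ⊕ v₀ ⊗ (x ⊗ u₀' ⊕ ⊝ (u₀ ⊗ u))
  expand = solve-∀ LPoly-ring
  cancel : ∀ r v m → r ⊕ v ⊗ (m ⊕ ⊝ m) ≋ r
  cancel = solve-∀ LPoly-ring

denominator-⊗-strip : ∀ l a l' j rest → l' ≤ l →
  denominator ⊗ embed (rectangle l' 0 (l ∸ l') (suc a) ⊗ℕ tElemUTail j rest) ≋ strip l l' a ⊗ elem j (uTail rest)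
denominator-⊗-strip l a l' j rest l'≤l = begin
  denominator ⊗ embed (R ⊗ℕ tElemUTail j rest)
    ≡⟨ cong (denominator ⊗_) (embed-⊗ R (tElemUTail j rest)) ⟩
  denominator ⊗ (embed R ⊗ embed (tElemUTail j rest))
    ≈⟨ ⊗-congˡ denominator (⊗-congˡ (embed R) (embed-tElemUTail j rest)) ⟩
  denominator ⊗ (embed R ⊗ ((q⁻¹ ⊗ tq) ⊗ E))
    ≈⟨ regroup denominator (embed R) q⁻¹ tq E ⟩
  q⁻¹ ⊗ (denominator ⊗ tq ⊗ embed R) ⊗ E
    ≈⟨ ⊗-congʳ E (⊗-congˡ q⁻¹ (rectangle-telescopes l' 0 (l ∸ l') (suc a))) ⟩
  q⁻¹ ⊗ (mono (+ L) (+ suc a) ⊕ ⊝ mono (+ l') (+ suc a) ⊕ ⊝ mono (+ L) (+ 0) ⊕ mono (+ l') (+ 0)) ⊗ E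
    ≡⟨ cong (λ n → q⁻¹ ⊗ (mono (+ n) (+ suc a) ⊕ ⊝ mono (+ l') (+ suc a) ⊕ ⊝ mono (+ n) (+ 0) ⊕ mono (+ l') (+ 0)) ⊗ E)
            (ℕ.m+[n∸m]≡n l'≤l) ⟩
  q⁻¹ ⊗ (mono (+ l) (+ suc a) ⊕ ⊝ mono (+ l') (+ suc a) ⊕ ⊝ mono (+ l) (+ 0) ⊕ mono (+ l') (+ 0)) ⊗ E
    ≈⟨ ⊗-congʳ E (distrib q⁻¹ (mono (+ l) (+ suc a)) (mono (+ l') (+ suc a)) (mono (+ l) (+ 0)) (mono (+ l') (+ 0))) ⟩
  strip l l' a ⊗ E ∎
  where
  open ≋-Reasoning
  R = rectangle l' 0 (l ∸ l') (suc a)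
  E = elem j (uTail rest)
  L = l' ℕ.+ (l ∸ l')
  q⁻¹ = mono (+ 0) -[1+ 0 ]
  tq = mono (+ 1) (+ 1)
  regroup : ∀ d r s m e → d ⊗ (r ⊗ ((s ⊗ m) ⊗ e)) ≋ s ⊗ (d ⊗ m ⊗ r) ⊗ e
  regroup = solve-∀ LPoly-ring
  distrib : ∀ s a b c d → s ⊗ (a ⊕ ⊝ b ⊕ ⊝ c ⊕ d) ≋ s ⊗ a ⊕ ⊝ (s ⊗ b) ⊕ ⊝ (s ⊗ c) ⊕ s ⊗ d
  distrib = solve-∀ LPoly-ring

Descending : List (ℕ × ℕ) → Set
Descending = Linked (λ c c' → proj₁ c' ≤ proj₁ c)

-- B k cs is the paper's B⁽ᵏ⁾ for the corner list cs, built by the recursion (†).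
B : ℕ → List (ℕ × ℕ) → ℕPoly
B zero          _                                = []
B (suc j)       []                               = []
B (suc j)       ((l , a) ∷ rest@((l' , _) ∷ _)) =
  B (suc j) rest ++ monoℕ l a ⊗ℕ B j rest ++ rectangle l' 0 (l ∸ l') (suc a) ⊗ℕ tElemUTail j rest
B (suc zero)    ((l , a) ∷ [])                   = rectangle 0 0 (suc l) (suc a)
B (suc (suc j)) ((l , a) ∷ [])                   = []

denominator-⊗-B-single : ∀ j l a → denominator ⊗ embed (B (suc j) ((l , a) ∷ [])) ≋ cornerNumerator (suc j) ((l , a) ∷ [])
denominator-⊗-B-single zero l a = begin
  denominator ⊗ embed R                          ≡⟨ ⊗-identityˡ (denominator ⊗ embed R) ⟨
  (x₀ ⊗ tq) ⊗ (denominator ⊗ embed R)            ≈⟨ regroup denominator (embed R) x₀ tq ⟩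
  x₀ ⊗ (denominator ⊗ tq ⊗ embed R)              ≈⟨ ⊗-congˡ x₀ (rectangle-telescopes 0 0 (suc l) (suc a)) ⟩
  x₀ ⊗ (mono (+ suc l) (+ suc a) ⊕ ⊝ mono (+ 0) (+ suc a) ⊕ ⊝ mono (+ suc l) (+ 0) ⊕ mono (+ 0) (+ 0))
                                                 ≈⟨ expand x₀ (mono (+ suc l) (+ suc a)) (mono (+ 0) (+ suc a)) (mono (+ suc l) (+ 0)) (mono (+ 0) (+ 0)) ⟩
  cornerNumerator 1 ((l , a) ∷ [])               ∎
  where
  open ≋-Reasoning
  R = rectangle 0 0 (suc l) (suc a)
  x₀ = mono -[1+ 0 ] -[1+ 0 ]
  tq = mono (+ 1) (+ 1)
  regroup : ∀ d r x m → (x ⊗ m) ⊗ (d ⊗ r) ≋ x ⊗ (d ⊗ m ⊗ r)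
  regroup = solve-∀ LPoly-ring
  expand : ∀ s a b c d → s ⊗ (a ⊕ ⊝ b ⊕ ⊝ c ⊕ d) ≋ (([] ⊕ s ⊗ a ⊗ one) ⊕ s ⊗ d ⊗ one) ⊕ ⊝ (([] ⊕ s ⊗ b ⊗ one) ⊕ s ⊗ c ⊗ one)
  expand = solve-∀ LPoly-ring
denominator-⊗-B-single (suc zero) l a = begin
  denominator ⊗ []                                     ≈⟨ expand denominator x₀ x u₀ u ⟩
  lhs ⊕ ⊝ (x₀ ⊗ x ⊕ ⊝ (u₀ ⊗ u))                        ≡⟨ cong (λ m → lhs ⊕ ⊝ (m ⊕ ⊝ (u₀ ⊗ u))) (cong (λ e → mono e (-[1+ 0 ] ℤ.+ + a)) (ℤ.+-comm -[1+ 0 ] (+ l))) ⟩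
  lhs ⊕ ⊝ (u₀ ⊗ u ⊕ ⊝ (u₀ ⊗ u))                        ≈⟨ cancel lhs (u₀ ⊗ u) ⟩
  cornerNumerator 2 ((l , a) ∷ [])                     ∎
  where
  open ≋-Reasoning
  x₀ = mono -[1+ 0 ] -[1+ 0 ]
  x = mono (+ l) (+ a)
  u₀ = mono (+ l) -[1+ 0 ]
  u = mono -[1+ 0 ] (+ a)
  lhs = cornerNumerator 2 ((l , a) ∷ [])
  expand : ∀ d x₀ x u₀ u → d ⊗ [] ≋ (([] ⊕ x ⊗ []) ⊕ x₀ ⊗ ([] ⊕ x ⊗ one)) ⊕ ⊝ (([] ⊕ u ⊗ []) ⊕ u₀ ⊗ ([] ⊕ u ⊗ one)) ⊕ ⊝ (x₀ ⊗ x ⊕ ⊝ (u₀ ⊗ u))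
  expand = solve-∀ LPoly-ring
  cancel : ∀ r m → r ⊕ ⊝ (m ⊕ ⊝ m) ≋ r
  cancel = solve-∀ LPoly-ring
denominator-⊗-B-single (suc (suc i)) l a = ≋-refl

denominator-⊗-B : ∀ k l a cs → Descending ((l , a) ∷ cs) →
  denominator ⊗ embed (B k ((l , a) ∷ cs)) ≋ cornerNumerator k ((l , a) ∷ cs)
denominator-⊗-B zero    l a cs                  _ = ⊗-zeroʳ-cancel denominator one
denominator-⊗-B (suc j) l a []                  _ = denominator-⊗-B-single j l a
denominator-⊗-B (suc j) l a rest@((l' , a') ∷ cs) (l'≤l ∷ descending) = begin
  denominator ⊗ embed (B (suc j) rest ++ monoℕ l a ⊗ℕ B j rest ++ R ⊗ℕ T)
    ≡⟨ cong (denominator ⊗_) (trans (embed-⊕ (B (suc j) rest) _) (cong (embed (B (suc j) rest) ⊕_)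
         (trans (embed-⊕ (monoℕ l a ⊗ℕ B j rest) _) (cong (_⊕ embed (R ⊗ℕ T)) (embed-⊗ (monoℕ l a) (B j rest)))))) ⟩
  denominator ⊗ (embed (B (suc j) rest) ⊕ (x ⊗ embed (B j rest) ⊕ embed (R ⊗ℕ T)))
    ≈⟨ distribute denominator (embed (B (suc j) rest)) x (embed (B j rest)) (embed (R ⊗ℕ T)) ⟩
  denominator ⊗ embed (B (suc j) rest) ⊕ (x ⊗ (denominator ⊗ embed (B j rest)) ⊕ denominator ⊗ embed (R ⊗ℕ T))
    ≈⟨ ⊕-cong (denominator-⊗-B (suc j) l' a' cs descending)
              (⊕-cong (⊗-congˡ x (denominator-⊗-B j l' a' cs descending)) (denominator-⊗-strip l a l' j rest l'≤l)) ⟩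
  cornerNumerator (suc j) rest ⊕ (x ⊗ cornerNumerator j rest ⊕ strip l l' a ⊗ elem j (uTail rest))
    ≈⟨ cornerNumerator-step j l a l' a' cs ⟨
  cornerNumerator (suc j) ((l , a) ∷ rest) ∎
  where
  open ≋-Reasoning
  x = mono (+ l) (+ a)
  R = rectangle l' 0 (l ∸ l') (suc a)
  T = tElemUTail j rest
  distribute : ∀ d b x b' r → d ⊗ (b ⊕ (x ⊗ b' ⊕ r)) ≋ d ⊗ b ⊕ (x ⊗ (d ⊗ b') ⊕ d ⊗ r)
  distribute = solve-∀ LPoly-ring

-- Corners are ordered by decreasing coleg

reverse⁺ : ∀ {A : Set} {R : A → A → Set} {xs} → Linked R xs → Linked (flip R) (reverse xs)
reverse⁺ []           = []
reverse⁺ {R = R} {_ ∷ _} Rxs = go [-] Rxs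
  where
  go : ∀ {x acc ys} → Linked (flip R) (x ∷ acc) → Linked R (x ∷ ys) → Linked (flip R) (foldl (flip _∷_) (x ∷ acc) ys)
  go acc [-]         = acc
  go acc (Rxy ∷ Rys) = go (Rxy ∷ acc) Rys

lower-head : ∀ {i ns} → Linked _≤_ (suc i ∷ ns) → Linked _≤_ (i ∷ ns)
lower-head [-]         = [-]
lower-head (i<n ∷ Rns) = ℕ.<⇒≤ i<n ∷ Rns

cornersRL-colegs : ∀ i rs → Linked _≤_ (i ∷ map proj₁ (cornersRL i rs))
cornersRL-colegs i []            = [-]
cornersRL-colegs i (r ∷ [])      = ℕ.≤-refl ∷ [-]
cornersRL-colegs i (r ∷ r' ∷ rs) with r' <ᵇ r | cornersRL-colegs (suc i) (r' ∷ rs)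
... | true  | above = ℕ.≤-refl ∷ lower-head above
... | false | above = lower-head above

corners-descending : ∀ μ → Descending (corners μ)
corners-descending μ = reverse⁺ (map⁻ (tail (cornersRL-colegs 0 (rows μ))))

theorem3p4 : (μ : Partition) → 1 ≤ length (corners μ) →
    (k : ℕ) → 1 ≤ k → k ≤ length (corners μ) →
    ∃[ P ] (denominator ⊗ embed P ≈L numerator k μ)
theorem3p4 μ m≥1 k _ _ with corners μ | m≥1 | corners-descending μ
... | []             | ()  | _
... | (l , a) ∷ cs   | _   | descending = B k ((l , a) ∷ cs) , coeff-≡ (denominator-⊗-B k l a cs descending)
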